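{- Let $P$ be a finite poset on two or more points and let $x$ be an element of $P$. Then $\operatorname{ldim}(P)\le 1+\operatorname{ldim}(P-\{x\})$.
   Context: $P-\{x\}$ is the subposet of $P$ on the remaining points. A partial linear extension (ple) of a poset $P$ is a linear extension of a subposet of $P$. For a family $\mathcal{L}$ of ple's, $\mu(u,\mathcal{L})$ is the number of members containing $u$ and $\mu(\mathcal{L})=\max_u\mu(u,\mathcal{L})$. A non-empty family $\mathcal{L}$ is a local realizer of $P$ if (1) whenever $x\le y$ in $P$ some $L\in\mathcal{L}$ has $x\le y$ in $L$, and (2) whenever $x\parallel y$ in $P$ some $L\in\mathcal{L}$ has $x>y$ in $L$. $\operatorname{ldim}(P)$ is the minimum of $\mu(\mathcal{L})$ over local realizers $\mathcal{L}$ of $P$. -}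

module Defs where

open import Data.Nat using (ℕ; zero; suc; _⊔_)
open import Data.Fin using (Fin; punchIn) renaming (_≤_ to _≤ᶠ_)
open import Data.Fin.Properties using (punchIn-injective) renaming (_≟_ to _≟ᶠ_)
open import Data.List using (List; []; length; lookup; filter; map; foldr; allFin)
open import Data.List.Membership.Propositional using (_∈_)
import Data.List.Membership.DecPropositional as DecMem
open import Data.List.Relation.Unary.All using (All)
open import Data.List.Relation.Unary.Any using (Any)
open import Data.List.Relation.Unary.Unique.Propositional using (Unique)
open import Data.Product using (Σ; ∃; _×_; _,_)
open import Relation.Binary.Structures using (IsPartialOrder; IsPreorder)
open import Relation.Binary.PropositionalEquality using (_≡_; _≢_; refl; cong; isEquivalence)
open import Relation.Nullary using (¬_)

record Poset (n : ℕ) : Set₁ where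
  field
    _≤P_ : Fin n → Fin n → Set
    isPartialOrder : IsPartialOrder _≡_ _≤P_

open Poset public

delete : ∀ {n} → Poset (suc n) → Fin (suc n) → Poset n
delete {n} P x = record { _≤P_ = R ; isPartialOrder = ipo }
  where
  module O = IsPartialOrder (isPartialOrder P)
  R : Fin n → Fin n → Set
  R a b = _≤P_ P (punchIn x a) (punchIn x b)
  ipo : IsPartialOrder _≡_ R
  ipo = record
    { isPreorder = record
      { isEquivalence = isEquivalence
      ; reflexive = λ { refl → O.refl }
      ; trans = O.trans }
    ; antisym = λ p q → punchIn-injective x _ _ (O.antisym p q) }

_∥_within_ : ∀ {n} → Fin n → Fin n → Poset n → Set
a ∥ b within P = ¬ (_≤P_ P a b) × ¬ (_≤P_ P b a)

-- A linear order on a finite set of points, given as a list (first = smallest).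
-- "a ≤ b in L": both occur in L, a at a position ≤ that of b.
Before : ∀ {n} → List (Fin n) → Fin n → Fin n → Set
Before L a b = Σ (Fin (length L)) λ i → Σ (Fin (length L)) λ j →
  (i ≤ᶠ j) × (lookup L i ≡ a) × (lookup L j ≡ b)

-- Partial linear extension: a linear extension of the subposet of P on the
-- points of L (L lists distinct points; the order of L extends P restricted).
IsPLE : ∀ {n} → Poset n → List (Fin n) → Set
IsPLE P L = Unique L × (∀ a b → a ∈ L → b ∈ L → _≤P_ P a b → Before L a b)

-- Local realizer: a non-empty family (list, i.e. multiset) of ple's.
IsLocalRealizer : ∀ {n} → Poset n → List (List (Fin n)) → Set
IsLocalRealizer P 𝓛 =
  (𝓛 ≢ []) × All (IsPLE P) 𝓛
  × (∀ a b → _≤P_ P a b → Any (λ L → Before L a b) 𝓛)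
  × (∀ a b → a ∥ b within P → Any (λ L → Before L b a × b ≢ a) 𝓛)

μ-at : ∀ {n} → Fin n → List (List (Fin n)) → ℕ
μ-at {n} u 𝓛 = length (filter (λ L → u ∈? L) 𝓛)
  where open DecMem (_≟ᶠ_ {n}) using (_∈?_)

μ : ∀ {n} → List (List (Fin n)) → ℕ
μ {n} 𝓛 = foldr _⊔_ 0 (map (λ u → μ-at u 𝓛) (allFin n))

IsLdim : ∀ {n} → Poset n → ℕ → Set
IsLdim P d =
  (∃ λ 𝓛 → IsLocalRealizer P 𝓛 × μ 𝓛 ≡ d)
  × (∀ 𝓛 → IsLocalRealizer P 𝓛 → d Data.Nat.≤ μ 𝓛)

-- Let 𝓛 be a local realizer of P − x and w a point of P − x, lying in some L₀ ∈ 𝓛. Keep every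
-- other L ∈ 𝓛, inserting x into it exactly when w ∈ L, and replace L₀ by two linear extensions
-- of L₀ + x, one with x as high and one with x as low as possible. A point v incomparable to x
-- and missing from L₀ is added to just one of the two copies: to the high one if some kept list
-- already puts x below v, to the low one otherwise. In the latter case v < x is realized by a
-- kept list containing both w and v, which exists since any two points share a member of 𝓛.
-- So every point of P − x gains at most one occurrence, while x occurs 1 + μ(w, 𝓛) times.
module Submission where

open import Defs
open import Data.Empty using (⊥-elim)
open import Data.Fin using (Fin; zero; suc; punchIn; punchOut)
open import Data.Fin.Properties using (_≟_; punchIn-injective; punchInᵢ≢i; punchIn-punchOut)
open import Data.List using (List; []; _∷_; _++_; map; filter; foldr; length; allFin)
open import Data.List.Properties
  using (map-++; map-cong; filter-accept; filter-reject; foldr-preservesᵒ; foldr-preservesᵇ)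
open import Data.List.Membership.Propositional using (_∈_; _∉_; find)
open import Data.List.Membership.Propositional.Properties
  using (∈-map⁺; ∈-map⁻; ∈-++⁺ˡ; ∈-++⁺ʳ; ∈-++⁻; ∈-filter⁺; ∈-filter⁻; ∈-lookup; ∈-allFin; ∈-∃++)
import Data.List.Membership.DecPropositional as DecMembership
open import Data.List.Relation.Unary.All as All using (All; _∷_)
open import Data.List.Relation.Unary.All.Properties as AllP using (All¬⇒¬Any; ¬Any⇒All¬)
open import Data.List.Relation.Unary.AllPairs as AllPairs using (_∷_)
open import Data.List.Relation.Unary.Any as Any using (Any; here; there; index)
open import Data.List.Relation.Unary.Any.Properties as AnyP using (lookup-index)
open import Data.List.Relation.Unary.Unique.Propositional using (Unique)
import Data.List.Relation.Unary.Unique.Propositional.Properties as UniqueP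
open import Data.List.Relation.Binary.Permutation.Propositional
  using (_↭_; ↭-refl; ↭-sym; ↭-trans; ↭-reflexive; prep; swap; ↭⇒↭ₛ)
open import Data.List.Relation.Binary.Permutation.Propositional.Properties
  using (∈-resp-↭; All-resp-↭; Any-resp-↭; shift; filter-↭; ↭-length; ↭-empty-inv)
import Data.List.Relation.Binary.Permutation.Setoid.Properties as Permutationₛ
open import Data.Nat using (ℕ; zero; suc; z≤n; s≤s; _+_; _≤_; _⊔_)
import Data.Nat as ℕ
open import Data.Nat.Properties
  using (module ≤-Reasoning; ≤-refl; ≤-trans; ≤-reflexive; n≤1+n; ⊔-lub; m≤n⇒m≤n⊔o; m≤n⇒m≤o⊔n)
open import Data.Product as Product using (∃; _×_; _,_; proj₁; proj₂)
open import Data.Sum as Sum using (_⊎_; inj₁; inj₂; [_,_]′)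
open import Function using (_∘_; id)
open import Level using (0ℓ)
open import Relation.Binary.Core using (Rel)
open import Relation.Binary.Definitions using (DecidableEquality)
open import Relation.Binary.PropositionalEquality as ≡ using (_≡_; _≢_; refl; sym; cong; subst; setoid)
open import Relation.Binary.Structures using (IsPartialOrder; IsDecPartialOrder)
open import Relation.Nullary using (¬_; Dec; yes; no; ¬?)
open import Relation.Nullary.Decidable as Dec using (_×-dec_; toSum; decidable-stable; ¬¬-excluded-middle)
open import Relation.Nullary.Negation using (¬¬-map)
open import Relation.Unary using (Pred; Decidable)
open import Relation.Unary.Properties using (∁?)

private variable
  A B : Set
  a b c : A
  L M : List A

Unique-head : Unique (a ∷ L) → a ∉ L
Unique-head (a∉L ∷ _) = All¬⇒¬Any a∉L

Unique-cons : a ∉ L → Unique L → Unique (a ∷ L)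
Unique-cons a∉L uL = ¬Any⇒All¬ _ a∉L ∷ uL

Unique-resp-↭ : ∀ {A : Set} {L M : List A} → L ↭ M → Unique L → Unique M
Unique-resp-↭ {A} = Permutationₛ.Unique-resp-↭ (setoid A) ∘ ↭⇒↭ₛ

filter-++-∁-↭ : ∀ {A : Set} {P : Pred A 0ℓ} (P? : Decidable P) L → filter P? L ++ filter (∁? P?) L ↭ L
filter-++-∁-↭ P? []      = ↭-refl
filter-++-∁-↭ P? (a ∷ L) with P? a
... | yes _ = prep a (filter-++-∁-↭ P? L)
... | no  _ = ↭-trans (shift a (filter P? L) _) (prep a (filter-++-∁-↭ P? L))

_∈?_ : ∀ {n} (v : Fin n) L → Dec (v ∈ L)
v ∈? L = DecMembership._∈?_ _≟_ v L

data Precedes {A : Set} : List A → A → A → Set where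
  now   : b ∈ a ∷ L → Precedes (a ∷ L) a b
  later : Precedes L a b → Precedes (c ∷ L) a b

Precedes-∈ˡ : Precedes L a b → a ∈ L
Precedes-∈ˡ (now _)   = here refl
Precedes-∈ˡ (later p) = there (Precedes-∈ˡ p)

Precedes-∈ʳ : Precedes L a b → b ∈ L
Precedes-∈ʳ (now b∈)  = b∈
Precedes-∈ʳ (later p) = there (Precedes-∈ʳ p)

Precedes-refl : a ∈ L → Precedes L a a
Precedes-refl (here refl) = now (here refl)
Precedes-refl (there a∈)  = later (Precedes-refl a∈)

Precedes-total : a ∈ L → b ∈ L → Precedes L a b ⊎ Precedes L b a
Precedes-total (here refl) b∈          = inj₁ (now b∈)
Precedes-total (there a∈)  (here refl) = inj₂ (now (there a∈))
Precedes-total (there a∈)  (there b∈)  = Sum.map later later (Precedes-total a∈ b∈)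

Precedes-antisym : Unique L → Precedes L a b → Precedes L b a → a ≡ b
Precedes-antisym _       (now _)   (now _)   = refl
Precedes-antisym u       (now _)   (later p) = ⊥-elim (Unique-head u (Precedes-∈ʳ p))
Precedes-antisym u       (later p) (now _)   = ⊥-elim (Unique-head u (Precedes-∈ʳ p))
Precedes-antisym (_ ∷ u) (later p) (later q) = Precedes-antisym u p q

Precedes-tail : a ≢ c → Precedes (c ∷ L) a b → Precedes L a b
Precedes-tail a≢c (now _)   = ⊥-elim (a≢c refl)
Precedes-tail _   (later p) = p

Precedes-map : (f : A → B) → Precedes L a b → Precedes (map f L) (f a) (f b)
Precedes-map f (now b∈)  = now (∈-map⁺ f b∈)
Precedes-map f (later p) = later (Precedes-map f p)

Precedes-++⁺ˡ : ∀ M → Precedes L a b → Precedes (L ++ M) a b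
Precedes-++⁺ˡ M (now b∈)  = now (∈-++⁺ˡ b∈)
Precedes-++⁺ˡ M (later p) = later (Precedes-++⁺ˡ M p)

Precedes-++⁺ʳ : ∀ L → Precedes M a b → Precedes (L ++ M) a b
Precedes-++⁺ʳ []      p = p
Precedes-++⁺ʳ (_ ∷ L) p = later (Precedes-++⁺ʳ L p)

Precedes-++⁺ : a ∈ L → b ∈ M → Precedes (L ++ M) a b
Precedes-++⁺ {L = a ∷ L} (here refl) b∈ = now (∈-++⁺ʳ (a ∷ L) b∈)
Precedes-++⁺ (there a∈)             b∈ = later (Precedes-++⁺ a∈ b∈)

Precedes-filter⁺ : {P : Pred A 0ℓ} (P? : Decidable P) →
                   P a → P b → Precedes L a b → Precedes (filter P? L) a b
Precedes-filter⁺ {L = c ∷ _} P? Pc Pb (now b∈) with P? c | ∈-filter⁺ P? b∈ Pb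
... | yes _  | b∈′ = now b∈′
... | no ¬Pc | _   = ⊥-elim (¬Pc Pc)
Precedes-filter⁺ {L = c ∷ _} P? Pa Pb (later p) with P? c
... | yes _ = later (Precedes-filter⁺ P? Pa Pb p)
... | no _  = Precedes-filter⁺ P? Pa Pb p

precedes? : DecidableEquality A → ∀ L a b → Dec (Precedes L a b)
precedes? _≟_ []      a b = no λ ()
precedes? _≟_ (c ∷ L) a b with a ≟ c | precedes? _≟_ L a b
... | _        | yes p = yes (later p)
... | yes refl | no ¬p = Dec.map′ now (λ { (now b∈) → b∈ ; (later p) → ⊥-elim (¬p p) })
                                   (DecMembership._∈?_ _≟_ b (c ∷ L))
... | no a≢c   | no ¬p = no λ { (now _) → a≢c refl ; (later p) → ¬p p }

Before⇒Precedes : ∀ {n} (L : List (Fin n)) {a b} → Before L a b → Precedes L a b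
Before⇒Precedes (c ∷ L) (zero  , j     , _       , refl , refl) = now (∈-lookup j)
Before⇒Precedes (c ∷ L) (suc i , suc j , s≤s i≤j , a≡ , b≡)  = later (Before⇒Precedes L (i , j , i≤j , a≡ , b≡))

Precedes⇒Before : ∀ {n} {L : List (Fin n)} {a b} → Precedes L a b → Before L a b
Precedes⇒Before (now b∈)  = zero , index b∈ , z≤n , refl , sym (lookup-index b∈)
Precedes⇒Before (later p) with Precedes⇒Before p
... | i , j , i≤j , a≡ , b≡ = suc i , suc j , s≤s i≤j , a≡ , b≡

Before⇒∈ : ∀ {n} {L : List (Fin n)} {a b} → Before L a b → a ∈ L × b ∈ L
Before⇒∈ {L = L} a≺b = Precedes-∈ˡ p , Precedes-∈ʳ p
  where p = Before⇒Precedes L a≺b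

module LinearExtension {A : Set} {_≤_ : Rel A 0ℓ} (≤-isDecPartialOrder : IsDecPartialOrder _≡_ _≤_) where

  open IsDecPartialOrder ≤-isDecPartialOrder using (antisym; trans; _≤?_)

  record IsLinearExtension (L : List A) : Set where
    field
      unique   : Unique L
      monotone : ∀ {b c} → b ∈ L → c ∈ L → b ≤ c → Precedes L b c

  open IsLinearExtension public

  IsLinearExtension-tail : ∀ {a L} → IsLinearExtension (a ∷ L) → IsLinearExtension L
  IsLinearExtension-tail ext = record
    { unique   = AllPairs.tail (unique ext)
    ; monotone = λ b∈ c∈ b≤c → Precedes-tail (λ { refl → Unique-head (unique ext) b∈ })
                                               (monotone ext (there b∈) (there c∈) b≤c)
    }

  Any-Precedes : ∀ {Ls b c} → All IsLinearExtension Ls → b ≤ c →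
                 Any (λ L → b ∈ L × c ∈ L) Ls → Any (λ L → Precedes L b c) Ls
  Any-Precedes (ext ∷ _)  b≤c (here (b∈ , c∈)) = here (monotone ext b∈ c∈ b≤c)
  Any-Precedes (_ ∷ exts) b≤c (there co)       = there (Any-Precedes exts b≤c co)

  insert : A → List A → List A
  insert y []      = y ∷ []
  insert y (a ∷ L) with y ≤? a
  ... | yes _ = y ∷ a ∷ L
  ... | no  _ = a ∷ insert y L

  insert-↭ : ∀ y L → insert y L ↭ y ∷ L
  insert-↭ y []      = prep y ↭-refl
  insert-↭ y (a ∷ L) with y ≤? a
  ... | yes _ = ↭-refl
  ... | no  _ = ↭-trans (prep a (insert-↭ y L)) (swap a y ↭-refl)

  Precedes-insert⁺ : ∀ y L {b c} → Precedes L b c → Precedes (insert y L) b c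
  Precedes-insert⁺ y (a ∷ L) p with y ≤? a | p
  ... | yes _ | _               = later p
  ... | no  _ | now (here refl) = now (here refl)
  ... | no  _ | now (there c∈)  = now (there (∈-resp-↭ (↭-sym (insert-↭ y L)) (there c∈)))
  ... | no  _ | later p′        = later (Precedes-insert⁺ y L p′)

  Precedes-insert-above : ∀ y L {c} → c ∈ L → y ≤ c → Precedes (insert y L) y c
  Precedes-insert-above y (a ∷ L) c∈ y≤c with y ≤? a | c∈
  ... | yes _   | _         = now (there c∈)
  ... | no  y≰a | here refl = ⊥-elim (y≰a y≤c)
  ... | no  _   | there c∈′ = later (Precedes-insert-above y L c∈′ y≤c)

  -- Were y put before a while c ≤ y ≤ a, linearity of L would give c = a, hence y = a ∈ L.
  Precedes-insert-below : ∀ y L {c} → IsLinearExtension L → y ∉ L → c ∈ L → c ≤ y →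
                          Precedes (insert y L) c y
  Precedes-insert-below y (a ∷ L) {c} ext y∉ c∈ c≤y with y ≤? a | c∈
  ... | yes y≤a | _         = ⊥-elim (y∉ (here (antisym y≤a (subst (_≤ y) c≡a c≤y))))
    where
    c≡a : c ≡ a
    c≡a = Precedes-antisym (unique ext) (monotone ext c∈ (here refl) (trans c≤y y≤a)) (now c∈)
  ... | no  _   | here refl = now (there (∈-resp-↭ (↭-sym (insert-↭ y L)) (here refl)))
  ... | no  _   | there c∈′ =
    later (Precedes-insert-below y L (IsLinearExtension-tail ext) (y∉ ∘ there) c∈′ c≤y)

  insert-isLinearExtension : ∀ y L → y ∉ L → IsLinearExtension L → IsLinearExtension (insert y L)
  insert-isLinearExtension y L y∉ ext = record
    { unique   = Unique-resp-↭ (↭-sym (insert-↭ y L)) (Unique-cons y∉ (unique ext))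
    ; monotone = mono
    }
    where
    mono : ∀ {b c} → b ∈ insert y L → c ∈ insert y L → b ≤ c → Precedes (insert y L) b c
    mono b∈ c∈ b≤c with ∈-resp-↭ (insert-↭ y L) b∈ | ∈-resp-↭ (insert-↭ y L) c∈
    ... | here refl | here refl = Precedes-refl b∈
    ... | here refl | there c∈L = Precedes-insert-above y L c∈L b≤c
    ... | there b∈L | here refl = Precedes-insert-below y L ext y∉ b∈L b≤c
    ... | there b∈L | there c∈L = Precedes-insert⁺ y L (monotone ext b∈L c∈L b≤c)

  insertAll : List A → List A → List A
  insertAll ys C = foldr insert C ys

  insertAll-↭ : ∀ ys C → insertAll ys C ↭ ys ++ C
  insertAll-↭ []       C = ↭-refl
  insertAll-↭ (y ∷ ys) C = ↭-trans (insert-↭ y (insertAll ys C)) (prep y (insertAll-↭ ys C))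

  Precedes-insertAll⁺ : ∀ ys C {b c} → Precedes C b c → Precedes (insertAll ys C) b c
  Precedes-insertAll⁺ []       C p = p
  Precedes-insertAll⁺ (y ∷ ys) C p = Precedes-insert⁺ y _ (Precedes-insertAll⁺ ys C p)

  insertAll-isLinearExtension : ∀ ys C → Unique (ys ++ C) → IsLinearExtension C →
                                IsLinearExtension (insertAll ys C)
  insertAll-isLinearExtension []       C _          ext = ext
  insertAll-isLinearExtension (y ∷ ys) C (y∉ ∷ u) ext =
    insert-isLinearExtension y _ (All¬⇒¬Any y∉ ∘ ∈-resp-↭ (insertAll-↭ ys C))
                             (insertAll-isLinearExtension ys C u ext)

  module Split (x : A) {D : Pred A 0ℓ} (D? : Decidable D) where

    split : List A → List A
    split C = filter D? C ++ x ∷ filter (∁? D?) C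

    split-↭ : ∀ C → split C ↭ x ∷ C
    split-↭ C = ↭-trans (shift x (filter D? C) _) (prep x (filter-++-∁-↭ D? C))

    Precedes-split⁺ : ∀ C {b c} → Precedes C b c → (D c → D b) → Precedes (split C) b c
    Precedes-split⁺ C {b} {c} p Dc⇒Db with D? b | D? c
    ... | yes Db | yes Dc = Precedes-++⁺ˡ _ (Precedes-filter⁺ D? Db Dc p)
    ... | yes Db | no ¬Dc =
      Precedes-++⁺ (∈-filter⁺ D? (Precedes-∈ˡ p) Db) (there (∈-filter⁺ (∁? D?) (Precedes-∈ʳ p) ¬Dc))
    ... | no ¬Db | yes Dc = ⊥-elim (¬Db (Dc⇒Db Dc))
    ... | no ¬Db | no ¬Dc = Precedes-++⁺ʳ (filter D? C) (later (Precedes-filter⁺ (∁? D?) ¬Db ¬Dc p))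

    Precedes-split-lower : ∀ C {c} → c ∈ C → D c → Precedes (split C) c x
    Precedes-split-lower C c∈ Dc = Precedes-++⁺ (∈-filter⁺ D? c∈ Dc) (here refl)

    Precedes-split-upper : ∀ C {c} → c ∈ C → ¬ D c → Precedes (split C) x c
    Precedes-split-upper C c∈ ¬Dc = Precedes-++⁺ʳ (filter D? C) (now (there (∈-filter⁺ (∁? D?) c∈ ¬Dc)))

    split-isLinearExtension : ∀ C → x ∉ C → IsLinearExtension C →
                              (∀ {b c} → b ∈ C → c ∈ C → b ≤ c → D c → D b) →
                              (∀ {c} → c ∈ C → c ≤ x → D c) →
                              (∀ {c} → c ∈ C → x ≤ c → ¬ D c) →
                              IsLinearExtension (split C)
    split-isLinearExtension C x∉ ext down-closed below above = record
      { unique   = Unique-resp-↭ (↭-sym (split-↭ C)) (Unique-cons x∉ (unique ext))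
      ; monotone = mono
      }
      where
      mono : ∀ {b c} → b ∈ split C → c ∈ split C → b ≤ c → Precedes (split C) b c
      mono b∈ c∈ b≤c with ∈-resp-↭ (split-↭ C) b∈ | ∈-resp-↭ (split-↭ C) c∈
      ... | here refl | here refl = Precedes-refl b∈
      ... | here refl | there c∈C = Precedes-split-upper C c∈C (above c∈C b≤c)
      ... | there b∈C | here refl = Precedes-split-lower C b∈C (below b∈C b≤c)
      ... | there b∈C | there c∈C = Precedes-split⁺ C (monotone ext b∈C c∈C b≤c) (down-closed b∈C c∈C b≤c)

module _ {n : ℕ} where

  μ-at-∈ : ∀ {u : Fin n} {L} Ls → u ∈ L → μ-at u (L ∷ Ls) ≡ suc (μ-at u Ls)
  μ-at-∈ {u} _ u∈L = cong length (filter-accept (u ∈?_) u∈L)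

  μ-at-∉ : ∀ {u : Fin n} {L} Ls → u ∉ L → μ-at u (L ∷ Ls) ≡ μ-at u Ls
  μ-at-∉ {u} _ u∉L = cong length (filter-reject (u ∈?_) u∉L)

  μ-at-∷-≤ : ∀ (u : Fin n) L Ls → μ-at u (L ∷ Ls) ≤ suc (μ-at u Ls)
  μ-at-∷-≤ u L Ls with toSum (u ∈? L)
  ... | inj₁ u∈L = ≤-reflexive (μ-at-∈ Ls u∈L)
  ... | inj₂ u∉L = ≤-trans (≤-reflexive (μ-at-∉ Ls u∉L)) (n≤1+n _)

  μ-at-∷-∷-≤ : ∀ (u : Fin n) L₁ L₂ Ls → μ-at u (L₁ ∷ L₂ ∷ Ls) ≤ 2 + μ-at u Ls
  μ-at-∷-∷-≤ u L₁ L₂ Ls = ≤-trans (μ-at-∷-≤ u L₁ (L₂ ∷ Ls)) (s≤s (μ-at-∷-≤ u L₂ Ls))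

  μ-at-∷-∷-disjoint-≤ : ∀ (u : Fin n) L₁ L₂ Ls → ¬ (u ∈ L₁ × u ∈ L₂) → μ-at u (L₁ ∷ L₂ ∷ Ls) ≤ suc (μ-at u Ls)
  μ-at-∷-∷-disjoint-≤ u L₁ L₂ Ls not-both with toSum (u ∈? L₁)
  ... | inj₁ u∈L₁ = ≤-reflexive (≡.trans (μ-at-∈ (L₂ ∷ Ls) u∈L₁) (cong suc (μ-at-∉ Ls (λ u∈L₂ → not-both (u∈L₁ , u∈L₂)))))
  ... | inj₂ u∉L₁ = ≤-trans (≤-reflexive (μ-at-∉ (L₂ ∷ Ls) u∉L₁)) (μ-at-∷-≤ u L₂ Ls)

  μ-at-resp-↭ : ∀ (u : Fin n) {Ls Ms} → Ls ↭ Ms → μ-at u Ls ≡ μ-at u Ms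
  μ-at-resp-↭ u σ = ↭-length (filter-↭ (u ∈?_) σ)

  μ-resp-↭ : ∀ {Ls Ms : List (List (Fin n))} → Ls ↭ Ms → μ Ls ≡ μ Ms
  μ-resp-↭ σ = cong (foldr _⊔_ 0) (map-cong (λ u → μ-at-resp-↭ u σ) (allFin n))

  μ-at≤μ : ∀ (u : Fin n) Ls → μ-at u Ls ≤ μ Ls
  μ-at≤μ u Ls =
    foldr-preservesᵒ {P = μ-at u Ls ≤_} (λ a b → [ m≤n⇒m≤n⊔o b , m≤n⇒m≤o⊔n a ]′) 0 _
                     (inj₂ (AnyP.map⁺ (Any.map (λ { refl → ≤-refl }) (∈-allFin u))))

  μ-lub : ∀ Ls {k} → (∀ (u : Fin n) → μ-at u Ls ≤ k) → μ Ls ≤ k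
  μ-lub Ls {k} bound = foldr-preservesᵇ {P = _≤ k} ⊔-lub z≤n (AllP.map⁺ (AllP.tabulate⁺ bound))

μ-at-map : ∀ {n k} (f : List (Fin n) → List (Fin k)) {u u′} →
           (∀ L → u ∈ L → u′ ∈ f L) → (∀ L → u′ ∈ f L → u ∈ L) →
           ∀ Ls → μ-at u′ (map f Ls) ≡ μ-at u Ls
μ-at-map f to from []       = refl
μ-at-map f {u} to from (L ∷ Ls) with toSum (u ∈? L)
... | inj₁ u∈L = ≡.trans (μ-at-∈ (map f Ls) (to L u∈L))
                      (≡.trans (cong suc (μ-at-map f to from Ls)) (sym (μ-at-∈ Ls u∈L)))
... | inj₂ u∉L = ≡.trans (μ-at-∉ (map f Ls) (u∉L ∘ from L))
                      (≡.trans (μ-at-map f to from Ls) (sym (μ-at-∉ Ls u∉L)))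

module _ {n : ℕ} (P : Poset n) where

  IsLocalRealizer-resp-↭ : ∀ {𝓛 𝓜} → 𝓛 ↭ 𝓜 → IsLocalRealizer P 𝓛 → IsLocalRealizer P 𝓜
  IsLocalRealizer-resp-↭ σ (nonempty , ples , comparable , incomparable) =
      (λ { refl → nonempty (↭-empty-inv σ) })
    , All-resp-↭ σ ples
    , (λ a b → Any-resp-↭ σ ∘ comparable a b)
    , (λ a b → Any-resp-↭ σ ∘ incomparable a b)

  co-occurrence : (∀ a b → Dec (_≤P_ P a b)) → ∀ {𝓛} → IsLocalRealizer P 𝓛 →
                  ∀ a b → Any (λ L → a ∈ L × b ∈ L) 𝓛
  co-occurrence _≤?_ (_ , _ , comparable , incomparable) a b with a ≤? b | b ≤? a
  ... | yes a≤b | _       = Any.map Before⇒∈ (comparable a b a≤b)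
  ... | no  _   | yes b≤a = Any.map (Product.swap ∘ Before⇒∈) (comparable b a b≤a)
  ... | no  a≰b | no  b≰a = Any.map (Product.swap ∘ Before⇒∈ ∘ proj₁) (incomparable a b (a≰b , b≰a))

¬¬-∀-Fin : ∀ {n} {P : Fin n → Set} → (∀ i → ¬ ¬ P i) → ¬ ¬ (∀ i → P i)
¬¬-∀-Fin {zero}  _    k = k λ ()
¬¬-∀-Fin {suc n} ¬¬P k =
  ¬¬P zero λ P0 → ¬¬-∀-Fin (¬¬P ∘ suc) λ Psuc → k λ { zero → P0 ; (suc i) → Psuc i }

¬¬-decidable : ∀ {n} (R : Fin n → Fin n → Set) → ¬ ¬ (∀ a b → Dec (R a b))
¬¬-decidable R = ¬¬-∀-Fin λ _ → ¬¬-∀-Fin λ _ → ¬¬-excluded-middle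

module Extension {m : ℕ} (P : Poset (suc (suc m))) (x : Fin (suc (suc m)))
                 (_≤?_ : ∀ a b → Dec (_≤P_ P a b)) where

  private
    Q : Poset (suc m)
    Q = delete P x

    _⊑_ : Fin (suc (suc m)) → Fin (suc (suc m)) → Set
    _⊑_ = _≤P_ P

    module ⊑ = IsPartialOrder (isPartialOrder P)

  ⊑-isDecPartialOrder : IsDecPartialOrder _≡_ _⊑_
  ⊑-isDecPartialOrder = record { isPartialOrder = isPartialOrder P ; _≟_ = _≟_ ; _≤?_ = _≤?_ }

  open LinearExtension ⊑-isDecPartialOrder

  IsLinearExtension⇒IsPLE : ∀ {L} → IsLinearExtension L → IsPLE P L
  IsLinearExtension⇒IsPLE ext = unique ext , λ _ _ a∈ b∈ a⊑b → Precedes⇒Before (monotone ext a∈ b∈ a⊑b)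

  pin : Fin (suc m) → Fin (suc (suc m))
  pin = punchIn x

  lift : List (Fin (suc m)) → List (Fin (suc (suc m)))
  lift = map pin

  data Point : Fin (suc (suc m)) → Set where
    the-x  : Point x
    pin-of : ∀ v → Point (pin v)

  point : ∀ a → Point a
  point a with x ≟ a
  ... | yes refl = the-x
  ... | no  x≢a  = subst Point (punchIn-punchOut x≢a) (pin-of (punchOut x≢a))

  ∈-lift⁻ : ∀ {v L} → pin v ∈ lift L → v ∈ L
  ∈-lift⁻ pv∈ with ∈-map⁻ pin pv∈
  ... | _ , v′∈ , pv≡pv′ = subst (_∈ _) (sym (punchIn-injective x _ _ pv≡pv′)) v′∈

  x∉lift : ∀ L → x ∉ lift L
  x∉lift L x∈ with ∈-map⁻ pin x∈
  ... | v , _ , x≡pv = punchInᵢ≢i x v (sym x≡pv)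

  lift-isLinearExtension : ∀ {L} → IsPLE Q L → IsLinearExtension (lift L)
  lift-isLinearExtension {L} (uL , mono) = record
    { unique   = UniqueP.map⁺ (punchIn-injective x _ _) uL
    ; monotone = mono′
    }
    where
    mono′ : ∀ {b c} → b ∈ lift L → c ∈ lift L → b ⊑ c → Precedes (lift L) b c
    mono′ b∈ c∈ b⊑c with ∈-map⁻ pin b∈ | ∈-map⁻ pin c∈
    ... | u , u∈ , refl | v , v∈ , refl = Precedes-map pin (Before⇒Precedes L (mono u v u∈ v∈ b⊑c))

  module _ (w : Fin (suc m)) {L₀ : List (Fin (suc m))} {R : List (List (Fin (suc m)))}
           (w∈L₀ : w ∈ L₀) (realizer : IsLocalRealizer Q (L₀ ∷ R)) where

    private
      L₀-ple : IsPLE Q L₀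
      L₀-ple = All.head (proj₁ (proj₂ realizer))

      R-ple : All (IsPLE Q) R
      R-ple = All.tail (proj₁ (proj₂ realizer))

      co-occurrenceQ : ∀ u v → Any (λ L → u ∈ L × v ∈ L) (L₀ ∷ R)
      co-occurrenceQ = co-occurrence Q (λ u v → pin u ≤? pin v) realizer

    attach : List (Fin (suc m)) → List (Fin (suc (suc m)))
    attach L with w ∈? L
    ... | yes _ = insert x (lift L)
    ... | no  _ = lift L

    attach-isLinearExtension : ∀ {L} → IsPLE Q L → IsLinearExtension (attach L)
    attach-isLinearExtension {L} ple with w ∈? L
    ... | yes _ = insert-isLinearExtension x (lift L) (x∉lift L) (lift-isLinearExtension ple)
    ... | no  _ = lift-isLinearExtension ple

    Precedes-attach⁺ : ∀ {L u v} → Precedes L u v → Precedes (attach L) (pin u) (pin v)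
    Precedes-attach⁺ {L} p with w ∈? L
    ... | yes _ = Precedes-insert⁺ x (lift L) (Precedes-map pin p)
    ... | no  _ = Precedes-map pin p

    ∈-attach⁺ : ∀ {L v} → v ∈ L → pin v ∈ attach L
    ∈-attach⁺ {L} v∈ with w ∈? L
    ... | yes _ = ∈-resp-↭ (↭-sym (insert-↭ x (lift L))) (there (∈-map⁺ pin v∈))
    ... | no  _ = ∈-map⁺ pin v∈

    ∈-attach⁻ : ∀ {L v} → pin v ∈ attach L → v ∈ L
    ∈-attach⁻ {L} {v} pv∈ with w ∈? L | pv∈
    ... | no  _ | pv∈′ = ∈-lift⁻ pv∈′
    ... | yes _ | pv∈′ with ∈-resp-↭ (insert-↭ x (lift L)) pv∈′
    ...   | here pv≡x  = ⊥-elim (punchInᵢ≢i x v pv≡x)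
    ...   | there pv∈″ = ∈-lift⁻ pv∈″

    x∈attach : ∀ {L} → w ∈ L → x ∈ attach L
    x∈attach {L} w∈ with w ∈? L
    ... | yes _  = ∈-resp-↭ (↭-sym (insert-↭ x (lift L))) (here refl)
    ... | no w∉ = ⊥-elim (w∉ w∈)

    x∈attach⁻ : ∀ {L} → x ∈ attach L → w ∈ L
    x∈attach⁻ {L} x∈ with w ∈? L | x∈
    ... | yes w∈ | _   = w∈
    ... | no  _  | x∈′ = ⊥-elim (x∉lift L x∈′)

    XFirst : Pred (Fin (suc m)) 0ℓ
    XFirst v = Any (λ L → Precedes (attach L) x (pin v)) R

    XFirst? : Decidable XFirst
    XFirst? v = Any.any? (λ L → precedes? _≟_ (attach L) x (pin v)) R

    Fresh : Pred (Fin (suc m)) 0ℓ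
    Fresh v = v ∉ L₀ × pin v ∥ x within P

    Fresh? : Decidable Fresh
    Fresh? v = ¬? (v ∈? L₀) ×-dec (¬? (pin v ≤? x) ×-dec ¬? (x ≤? pin v))

    module Completion {S : Pred (Fin (suc m)) 0ℓ} (S? : Decidable S) (S⇒Fresh : ∀ {v} → S v → Fresh v)
                      {D : Pred (Fin (suc (suc m))) 0ℓ} (D? : Decidable D) where

      open Split x D?

      extras : List (Fin (suc m))
      extras = filter S? (allFin (suc m))

      base : List (Fin (suc (suc m)))
      base = insertAll (lift extras) (lift L₀)

      completed : List (Fin (suc (suc m)))
      completed = split base

      base-↭ : base ↭ lift (extras ++ L₀)
      base-↭ = ↭-trans (insertAll-↭ (lift extras) (lift L₀)) (↭-reflexive (sym (map-++ pin extras L₀)))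

      ∈-base : ∀ {v} → v ∈ L₀ ⊎ S v → pin v ∈ base
      ∈-base v∈ = ∈-resp-↭ (↭-sym base-↭)
                    (∈-map⁺ pin ([ ∈-++⁺ʳ extras , ∈-++⁺ˡ ∘ ∈-filter⁺ S? (∈-allFin _) ]′ v∈))

      ∈-base⁻ : ∀ {v} → pin v ∈ base → v ∈ L₀ ⊎ S v
      ∈-base⁻ pv∈ with ∈-++⁻ extras (∈-lift⁻ (∈-resp-↭ base-↭ pv∈))
      ... | inj₁ v∈ = inj₂ (proj₂ (∈-filter⁻ S? v∈))
      ... | inj₂ v∈ = inj₁ v∈

      x∉base : x ∉ base
      x∉base = x∉lift (extras ++ L₀) ∘ ∈-resp-↭ base-↭

      x∈completed : x ∈ completed
      x∈completed = ∈-resp-↭ (↭-sym (split-↭ base)) (here refl)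

      ∈-completed⁺ : ∀ {v} → v ∈ L₀ ⊎ S v → pin v ∈ completed
      ∈-completed⁺ = ∈-resp-↭ (↭-sym (split-↭ base)) ∘ there ∘ ∈-base

      ∈-completed⁻ : ∀ {v} → pin v ∈ completed → v ∈ L₀ ⊎ S v
      ∈-completed⁻ {v} pv∈ with ∈-resp-↭ (split-↭ base) pv∈
      ... | here pv≡x  = ⊥-elim (punchInᵢ≢i x v pv≡x)
      ... | there pv∈′ = ∈-base⁻ pv∈′

      base-isLinearExtension : IsLinearExtension base
      base-isLinearExtension =
        insertAll-isLinearExtension (lift extras) (lift L₀)
          (subst Unique (map-++ pin extras L₀) (UniqueP.map⁺ (punchIn-injective x _ _) extras++L₀-unique))
          (lift-isLinearExtension L₀-ple)
        where
        extras++L₀-unique : Unique (extras ++ L₀)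
        extras++L₀-unique = UniqueP.++⁺ (UniqueP.filter⁺ S? (UniqueP.allFin⁺ (suc m))) (proj₁ L₀-ple)
                              λ (v∈extras , v∈L₀) → proj₁ (S⇒Fresh (proj₂ (∈-filter⁻ S? v∈extras))) v∈L₀

      ⊑x⇒⋣x : ∀ {c} → c ∈ base → c ⊑ x → ¬ x ⊑ c
      ⊑x⇒⋣x c∈ c⊑x x⊑c = x∉base (subst (_∈ base) (⊑.antisym c⊑x x⊑c) c∈)

      completed-isLinearExtension : (∀ {b c} → b ∈ base → c ∈ base → b ⊑ c → D c → D b) →
                                    (∀ {c} → c ∈ base → c ⊑ x → D c) →
                                    (∀ {c} → c ∈ base → x ⊑ c → ¬ D c) →
                                    IsLinearExtension completed
      completed-isLinearExtension = split-isLinearExtension base x∉base base-isLinearExtension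

      Precedes-completed-L₀ : ∀ {a b} → Precedes (lift L₀) a b → (D b → D a) → Precedes completed a b
      Precedes-completed-L₀ p = Precedes-split⁺ base (Precedes-insertAll⁺ (lift extras) (lift L₀) p)

      Precedes-completed-lower : ∀ {v} → v ∈ L₀ ⊎ S v → D (pin v) → Precedes completed (pin v) x
      Precedes-completed-lower v∈ = Precedes-split-lower base (∈-base v∈)

      Precedes-completed-upper : ∀ {v} → v ∈ L₀ ⊎ S v → ¬ D (pin v) → Precedes completed x (pin v)
      Precedes-completed-upper v∈ = Precedes-split-upper base (∈-base v∈)

    -- In the high copy x follows every point not above it, in the low copy it precedes every
    -- point not below it; XFirst decides which copy receives a fresh point.
    module High = Completion {S = λ v → Fresh v × XFirst v} (λ v → Fresh? v ×-dec XFirst? v) proj₁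
                             {D = λ a → ¬ x ⊑ a} (λ a → ¬? (x ≤? a))
    module Low  = Completion {S = λ v → Fresh v × ¬ XFirst v} (λ v → Fresh? v ×-dec ¬? (XFirst? v)) proj₁
                             {D = _⊑ x} (_≤? x)

    family : List (List (Fin (suc (suc m))))
    family = High.completed ∷ Low.completed ∷ map attach R

    family-isLinearExtension : All IsLinearExtension family
    family-isLinearExtension =
        High.completed-isLinearExtension (λ _ _ b⊑c x⋢c x⊑b → x⋢c (⊑.trans x⊑b b⊑c))
                                         High.⊑x⇒⋣x
                                         (λ _ x⊑c x⋢c → x⋢c x⊑c)
      ∷ Low.completed-isLinearExtension (λ _ _ → ⊑.trans)
                                        (λ _ c⊑x → c⊑x)
                                        (λ c∈ x⊑c c⊑x → Low.⊑x⇒⋣x c∈ c⊑x x⊑c)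
      ∷ AllP.map⁺ (All.map attach-isLinearExtension R-ple)

    x-co-occurrence : ∀ v → Any (λ L → x ∈ L × pin v ∈ L) family
    x-co-occurrence v with co-occurrenceQ w v
    ... | here (_ , v∈L₀) = here (High.x∈completed , High.∈-completed⁺ (inj₁ v∈L₀))
    ... | there co        = there (there (AnyP.map⁺ (Any.map (Product.map x∈attach ∈-attach⁺) co)))

    pin-co-occurrence : ∀ u v → Any (λ L → pin u ∈ L × pin v ∈ L) family
    pin-co-occurrence u v with co-occurrenceQ u v
    ... | here (u∈L₀ , v∈L₀) = here (High.∈-completed⁺ (inj₁ u∈L₀) , High.∈-completed⁺ (inj₁ v∈L₀))
    ... | there co = there (there (AnyP.map⁺ (Any.map (Product.map ∈-attach⁺ ∈-attach⁺) co)))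

    family-co-occurrence : ∀ a b → Any (λ L → a ∈ L × b ∈ L) family
    family-co-occurrence a b with point a | point b
    ... | the-x    | the-x    = here (High.x∈completed , High.x∈completed)
    ... | the-x    | pin-of v = x-co-occurrence v
    ... | pin-of u | the-x    = Any.map Product.swap (x-co-occurrence u)
    ... | pin-of u | pin-of v = pin-co-occurrence u v

    L₀-isLinearExtension : IsLinearExtension (lift L₀)
    L₀-isLinearExtension = lift-isLinearExtension L₀-ple

    Precedes-L₀ : ∀ {a b} → Precedes (lift L₀) a b → Any (λ L → Precedes L a b) family
    Precedes-L₀ {a} {b} a≺b with b ≤? x
    ... | no  b⋢x = there (here (Low.Precedes-completed-L₀ a≺b (⊥-elim ∘ b⋢x)))
    ... | yes b⊑x = here (High.Precedes-completed-L₀ a≺b λ x⋢b x⊑a → x⋢b (subst (x ⊑_) (a≡b x⊑a) x⊑a))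
      where
      a≡b : x ⊑ a → a ≡ b
      a≡b x⊑a = Precedes-antisym (unique L₀-isLinearExtension) a≺b
                  (monotone L₀-isLinearExtension (Precedes-∈ʳ a≺b) (Precedes-∈ˡ a≺b) (⊑.trans b⊑x x⊑a))

    Precedes-before-x : ∀ v → pin v ∥ x within P → Any (λ L → Precedes L (pin v) x) family
    Precedes-before-x v inc with v ∈? L₀ | XFirst? v
    ... | yes v∈L₀ | _         = here (High.Precedes-completed-lower (inj₁ v∈L₀) (proj₂ inc))
    ... | no  v∉L₀ | yes first = here (High.Precedes-completed-lower (inj₂ ((v∉L₀ , inc) , first)) (proj₂ inc))
    ... | no  v∉L₀ | no ¬first with co-occurrenceQ w v
    ...   | here (_ , v∈L₀) = ⊥-elim (v∉L₀ v∈L₀)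
    ...   | there co        = there (there (AnyP.map⁺ ([ id , ⊥-elim ∘ ¬first ]′ (AnyP.Any-⊎⁻ (Any.map orient co)))))
      where
      orient : ∀ {L} → w ∈ L × v ∈ L → Precedes (attach L) (pin v) x ⊎ Precedes (attach L) x (pin v)
      orient (w∈ , v∈) = Precedes-total (∈-attach⁺ v∈) (x∈attach w∈)

    Precedes-x-before : ∀ v → pin v ∥ x within P → Any (λ L → Precedes L x (pin v)) family
    Precedes-x-before v inc with v ∈? L₀ | XFirst? v
    ... | yes v∈L₀ | _          = there (here (Low.Precedes-completed-upper (inj₁ v∈L₀) (proj₁ inc)))
    ... | no  _    | yes first  = there (there (AnyP.map⁺ first))
    ... | no  v∉L₀ | no  ¬first = there (here (Low.Precedes-completed-upper (inj₂ ((v∉L₀ , inc) , ¬first)) (proj₁ inc)))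

    family-incomparable : ∀ a b → a ∥ b within P → Any (λ L → Precedes L b a) family
    family-incomparable a b inc with point a | point b
    ... | the-x    | the-x    = ⊥-elim (proj₁ inc ⊑.refl)
    ... | the-x    | pin-of v = Precedes-before-x v (Product.swap inc)
    ... | pin-of u | the-x    = Precedes-x-before u inc
    ... | pin-of u | pin-of v with proj₂ (proj₂ (proj₂ realizer)) u v inc
    ...   | here (v≺u , _) = Precedes-L₀ (Precedes-map pin (Before⇒Precedes L₀ v≺u))
    ...   | there v≺u      = there (there (AnyP.map⁺ (Any.map (λ {L} → Precedes-attach⁺ ∘ Before⇒Precedes L ∘ proj₁) v≺u)))

    family-isLocalRealizer : IsLocalRealizer P family
    family-isLocalRealizer =
        (λ ())
      , All.map IsLinearExtension⇒IsPLE family-isLinearExtension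
      , (λ a b a⊑b → Any.map Precedes⇒Before
                       (Any-Precedes family-isLinearExtension a⊑b (family-co-occurrence a b)))
      , (λ a b inc → Any.map (λ b≺a → Precedes⇒Before b≺a , λ { refl → proj₁ inc ⊑.refl })
                       (family-incomparable a b inc))

    μ-at-family-x : μ-at x family ≤ suc (μ-at w (L₀ ∷ R))
    μ-at-family-x = begin
      μ-at x family                   ≤⟨ μ-at-∷-∷-≤ x High.completed Low.completed (map attach R) ⟩
      2 + μ-at x (map attach R)       ≡⟨ cong (2 +_) (μ-at-map attach (λ _ → x∈attach) (λ _ → x∈attach⁻) R) ⟩
      2 + μ-at w R                    ≡⟨ cong suc (μ-at-∈ R w∈L₀) ⟨
      suc (μ-at w (L₀ ∷ R))           ∎
      where open ≤-Reasoning

    μ-at-attach : ∀ v → μ-at (pin v) (map attach R) ≡ μ-at v R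
    μ-at-attach v = μ-at-map attach (λ _ → ∈-attach⁺) (λ _ → ∈-attach⁻) R

    μ-at-family-pin : ∀ v → μ-at (pin v) family ≤ suc (μ-at v (L₀ ∷ R))
    μ-at-family-pin v with toSum (v ∈? L₀)
    ... | inj₁ v∈L₀ = begin
      μ-at (pin v) family               ≤⟨ μ-at-∷-∷-≤ (pin v) High.completed Low.completed (map attach R) ⟩
      2 + μ-at (pin v) (map attach R)   ≡⟨ cong (2 +_) (μ-at-attach v) ⟩
      2 + μ-at v R                      ≡⟨ cong suc (μ-at-∈ R v∈L₀) ⟨
      suc (μ-at v (L₀ ∷ R))             ∎
      where open ≤-Reasoning
    ... | inj₂ v∉L₀ = begin
      μ-at (pin v) family               ≤⟨ μ-at-∷-∷-disjoint-≤ (pin v) _ _ _ not-both ⟩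
      suc (μ-at (pin v) (map attach R)) ≡⟨ cong suc (μ-at-attach v) ⟩
      suc (μ-at v R)                    ≡⟨ cong suc (μ-at-∉ R v∉L₀) ⟨
      suc (μ-at v (L₀ ∷ R))             ∎
      where
      open ≤-Reasoning
      not-both : ¬ (pin v ∈ High.completed × pin v ∈ Low.completed)
      not-both (∈High , ∈Low) with High.∈-completed⁻ ∈High | Low.∈-completed⁻ ∈Low
      ... | inj₁ v∈L₀        | _                 = v∉L₀ v∈L₀
      ... | inj₂ _           | inj₁ v∈L₀         = v∉L₀ v∈L₀
      ... | inj₂ (_ , first) | inj₂ (_ , ¬first) = ¬first first

    μ-family-≤ : μ family ≤ suc (μ (L₀ ∷ R))
    μ-family-≤ = μ-lub family bound
      where
      bound : ∀ a → μ-at a family ≤ suc (μ (L₀ ∷ R))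
      bound a with point a
      ... | the-x    = ≤-trans μ-at-family-x (s≤s (μ-at≤μ w (L₀ ∷ R)))
      ... | pin-of v = ≤-trans (μ-at-family-pin v) (s≤s (μ-at≤μ v (L₀ ∷ R)))

    extension : ∃ λ 𝓛⁺ → IsLocalRealizer P 𝓛⁺ × μ 𝓛⁺ ≤ suc (μ (L₀ ∷ R))
    extension = family , family-isLocalRealizer , μ-family-≤

extend-realizer : ∀ {m} (P : Poset (suc (suc m))) x → (∀ a b → Dec (_≤P_ P a b)) →
                  ∀ {𝓛} → IsLocalRealizer (delete P x) 𝓛 →
                  ∃ λ 𝓛⁺ → IsLocalRealizer P 𝓛⁺ × μ 𝓛⁺ ≤ suc (μ 𝓛)
-- Any point of P − x serves as w, say zero; this is where |P| ≥ 2 is used.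
extend-realizer P x _≤?_ realizer@(_ , _ , comparable , _)
  with L₀ , L₀∈𝓛 , w≺w ← find (comparable zero zero (IsPartialOrder.refl (isPartialOrder P)))
  with pre , post , refl ← ∈-∃++ L₀∈𝓛
  = Product.map₂ (Product.map₂ (subst (λ k → _ ≤ suc k) (sym (μ-resp-↭ σ))))
                 (extension zero (proj₁ (Before⇒∈ w≺w)) (IsLocalRealizer-resp-↭ (delete P x) σ realizer))
  where
  open Extension P x _≤?_
  σ : pre ++ L₀ ∷ post ↭ L₀ ∷ pre ++ post
  σ = shift L₀ pre post

theorem3p2 : (m : ℕ) (P : Poset (2 + m)) (x : Fin (2 + m)) (d e : ℕ) →
    IsLdim P d → IsLdim (delete P x) e → d ≤ 1 + e
-- The order of P need not be decidable, but the goal is, so decidability may be assumed.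
theorem3p2 m P x d e (_ , minimal) ((𝓛 , realizer , refl) , _) =
  decidable-stable (d ℕ.≤? 1 + μ 𝓛) (¬¬-map bound (¬¬-decidable (_≤P_ P)))
  where
  bound : (∀ a b → Dec (_≤P_ P a b)) → d ≤ 1 + μ 𝓛
  bound _≤?_ with 𝓛⁺ , realizer⁺ , μ𝓛⁺≤ ← extend-realizer P x _≤?_ realizer = ≤-trans (minimal 𝓛⁺ realizer⁺) μ𝓛⁺≤
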